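{- Let $D=\{\mathbf{v}_1,\dots,\mathbf{v}_m\}$ be a $\mathrm{DD}(m)$ and $k$ a positive integer. Then $C_k(D)\le\sum_{i=1}^k|H_i|$, with equality if and only if the vectors $\sum_{i=1}^m a_i\mathbf{v}_i$, for $(a_1,\dots,a_m)\in\bigcup_{j=0}^k H_j$, are all distinct (i.e. distinct tuples give distinct vectors).
   Context: A $\mathrm{DD}(m)$ is a set of $m$ points of $\mathbb{Z}^2$ whose difference vectors $\mathbf{v}_i-\mathbf{v}_j$ ($i\ne j$) are all distinct. The $k$-hop coverage $C_k(D)$ is the number of non-zero vectors of the form $\sum_{i=1}^{\ell}(\mathbf{v}_{\alpha_i}-\mathbf{v}_{\beta_i})$ with $\alpha_i\ne\beta_i$ and $0\le\ell\le k$. For a non-negative integer $j$, $H_j=\{(a_1,\dots,a_m)\in\mathbb{Z}^m:\sum_{i=1}^m a_i=0,\ \sum_{\{i:a_i>0\}}a_i=j\}$. -}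

module Defs where

open import Data.Nat using (ℕ; zero; suc; _≤_)
import Data.Nat as ℕ
open import Data.Integer using (ℤ; +_; 0ℤ; _<?_; _*_; _+_; _-_)
open import Data.Fin using (Fin)
open import Data.Vec using (Vec; []; _∷_)
open import Data.List using (List; []; _∷_; length)
open import Data.List.Relation.Unary.All using (All)
open import Data.Product using (_×_; _,_; Σ; ∃; ∃-syntax)
open import Relation.Binary.PropositionalEquality using (_≡_; _≢_)
open import Relation.Nullary using (does)
open import Data.Bool using (if_then_else_)
open import Function.Definitions using (Injective)

ℤ² : Set
ℤ² = ℤ × ℤ

0² : ℤ²
0² = (0ℤ , 0ℤ)

_+²_ : ℤ² → ℤ² → ℤ²
(a , b) +² (c , d) = (a + c , b + d)

_-²_ : ℤ² → ℤ² → ℤ²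
(a , b) -² (c , d) = (a - c , b - d)

_·²_ : ℤ → ℤ² → ℤ²
n ·² (a , b) = (n * a , n * b)

-- D = {v_1,...,v_m} given as an indexed family v : Fin m → ℤ²
-- DD(m): the difference vectors v_i - v_j (i ≠ j) are pairwise distinct
IsDD : {m : ℕ} → (Fin m → ℤ²) → Set
IsDD {m} v = ∀ (i j i' j' : Fin m) → i ≢ j → i' ≢ j' →
  (v i -² v j) ≡ (v i' -² v j') → (i ≡ i') × (j ≡ j')

sumDiffs : {m : ℕ} → (Fin m → ℤ²) → List (Fin m × Fin m) → ℤ²
sumDiffs v [] = 0²
sumDiffs v ((α , β) ∷ ps) = (v α -² v β) +² sumDiffs v ps

CkSet : {m : ℕ} → (Fin m → ℤ²) → ℕ → ℤ² → Set
CkSet {m} v k w =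
  (w ≢ 0²) ×
  ∃[ ps ] (length ps ≤ k × All (λ p → Data.Product.proj₁ p ≢ Data.Product.proj₂ p) ps
           × sumDiffs v ps ≡ w)

-- "the set P ⊆ A has exactly n elements": an injective enumeration
-- Fin n → A whose image is exactly P
IsCard : {A : Set} → (A → Set) → ℕ → Set
IsCard {A} P n = Σ (Fin n → A) λ f →
  Injective _≡_ _≡_ f × (∀ i → P (f i)) × (∀ x → P x → ∃[ i ] f i ≡ x)

sumℤ : {m : ℕ} → Vec ℤ m → ℤ
sumℤ [] = 0ℤ
sumℤ (x ∷ xs) = x + sumℤ xs

posSum : {m : ℕ} → Vec ℤ m → ℤ
posSum [] = 0ℤ
posSum (x ∷ xs) = (if does (0ℤ <? x) then x else 0ℤ) + posSum xs

H : (m : ℕ) → ℕ → Vec ℤ m → Set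
H m j a = (sumℤ a ≡ 0ℤ) × (posSum a ≡ + j)

linComb : {m : ℕ} → Vec ℤ m → (Fin m → ℤ²) → ℤ²
linComb [] v = 0²
linComb (x ∷ xs) v = (x ·² v Fin.zero) +² linComb xs (λ i → v (Fin.suc i))
  where import Data.Fin as Fin

sum1to : (ℕ → ℕ) → ℕ → ℕ
sum1to h zero = 0
sum1to h (suc k) = sum1to h k ℕ.+ h (suc k)

InUnionH : (m : ℕ) → ℕ → Vec ℤ m → Set
InUnionH m k a = ∃[ j ] (j ≤ k × H m j a)

DistinctReps : {m : ℕ} → (Fin m → ℤ²) → ℕ → Set
DistinctReps {m} v k = ∀ (a b : Vec ℤ m) → InUnionH m k a → InUnionH m k b →
  linComb a v ≡ linComb b v → a ≡ b

-- A sum of ℓ differences v_α − v_β is Σ aᵢ vᵢ for its coefficient tuple a, which has zero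
-- sum and positive part Σ⁺ a ≤ ℓ, so a ∈ H_j for some j ≤ k, and j ≥ 1 when the vector is
-- non-zero (H₀ = {0}). Conversely each a ∈ H_j is a sum of exactly j differences, pairing the
-- positive units of a with its negative units. So a ↦ Σ aᵢ vᵢ maps the disjoint union
-- H₁ ∪ … ∪ H_k onto C_k(D) (plus possibly 0), whence the inequality, with equality exactly
-- when this map is injective and avoids 0, i.e. when it is injective on H₀ ∪ … ∪ H_k.

module Submission where

open import Defs
open import Data.Nat using (ℕ; _≤_)
open import Data.Fin using (Fin)
open import Data.Product using (_×_)
open import Relation.Binary.PropositionalEquality using (_≡_)
open import Function.Bundles using (_⇔_)

open import Data.Nat using (zero; suc; z≤n; s≤s)
import Data.Nat as ℕ
import Data.Nat.Properties as ℕP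
open import Data.Integer using (ℤ; +_; -[1+_]; 0ℤ; 1ℤ; -1ℤ; _+_; _-_; _*_; _<?_)
import Data.Integer as ℤ
import Data.Integer.Properties as ℤP
open import Data.Integer.Tactic.RingSolver using (solve-∀)
import Algebra.Properties.CommutativeSemigroup ℕP.+-commutativeSemigroup as ℕ+
import Algebra.Properties.CommutativeSemigroup ℤP.+-commutativeSemigroup as ℤ+
open import Data.Fin using (splitAt; join; punchOut)
import Data.Fin as F
open import Data.Fin.Properties using (splitAt-↑ˡ; splitAt-↑ʳ; join-splitAt; injective⇒≤; punchOut-injective; any?; _≟_)
open import Data.Vec using (Vec; []; _∷_; lookup; replicate; _[_]%=_)
open import Data.List using (List; []; _∷_; length; _++_; map; zip)
import Data.List as List
import Data.List.Properties as ListP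
open import Data.List.Relation.Unary.All using (All; []; _∷_)
import Data.List.Relation.Unary.All as All
open import Data.List.Relation.Unary.All.Properties using (++⁺; map⁺; replicate⁺)
open import Data.Product using (∃-syntax; _,_; proj₁; proj₂)
open import Data.Sum using (_⊎_; inj₁; inj₂; [_,_])
open import Data.Empty using (⊥; ⊥-elim)
open import Relation.Nullary using (does; yes; no)
open import Relation.Binary.PropositionalEquality using (refl; sym; trans; cong; cong₂; subst; _≢_; module ≡-Reasoning)
open import Data.Bool using (if_then_else_)
open import Function using (_∘_)
open import Function.Bundles using (mk⇔; Equivalence)
open import Function.Definitions using (Injective)

-+-interchange : ∀ a b c d → (a - b) + (c - d) ≡ (a + c) - (b + d)
-+-interchange = solve-∀

+²-identityˡ : ∀ p → 0² +² p ≡ p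
+²-identityˡ (a , b) = cong₂ _,_ (ℤP.+-identityˡ a) (ℤP.+-identityˡ b)

+²-identityʳ : ∀ p → p +² 0² ≡ p
+²-identityʳ (a , b) = cong₂ _,_ (ℤP.+-identityʳ a) (ℤP.+-identityʳ b)

+²-assoc : ∀ p q r → (p +² q) +² r ≡ p +² (q +² r)
+²-assoc (a , a′) (b , b′) (c , c′) = cong₂ _,_ (ℤP.+-assoc a b c) (ℤP.+-assoc a′ b′ c′)

+²-leftCommute : ∀ p q r → p +² (q +² r) ≡ q +² (p +² r)
+²-leftCommute (a , a′) (b , b′) (c , c′) = cong₂ _,_ (ℤ+.x∙yz≈y∙xz a b c) (ℤ+.x∙yz≈y∙xz a′ b′ c′)

-²-+²-interchange : ∀ p q r s → (p -² q) +² (r -² s) ≡ (p +² r) -² (q +² s)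
-²-+²-interchange (a , a′) (b , b′) (c , c′) (d , d′) =
  cong₂ _,_ (-+-interchange a b c d) (-+-interchange a′ b′ c′ d′)

·²-zeroˡ : ∀ p → 0ℤ ·² p ≡ 0²
·²-zeroˡ (a , b) = refl

·²-identityˡ : ∀ p → 1ℤ ·² p ≡ p
·²-identityˡ (a , b) = cong₂ _,_ (ℤP.*-identityˡ a) (ℤP.*-identityˡ b)

·²-distribʳ-+ : ∀ x y p → (x + y) ·² p ≡ (x ·² p) +² (y ·² p)
·²-distribʳ-+ x y (a , b) = cong₂ _,_ (ℤP.*-distribʳ-+ a x y) (ℤP.*-distribʳ-+ b x y)

·²-distribʳ-- : ∀ x y p → (x - y) ·² p ≡ (x ·² p) -² (y ·² p)
·²-distribʳ-- x y (a , b) = cong₂ _,_ (distrib x y a) (distrib x y b)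
  where
  distrib : ∀ x y a → (x - y) * a ≡ x * a - y * a
  distrib = solve-∀

-1·q+²[1·p+²r]≡[p-²q]+²r : ∀ p q r → (-1ℤ ·² q) +² ((1ℤ ·² p) +² r) ≡ (p -² q) +² r
-1·q+²[1·p+²r]≡[p-²q]+²r (a , a′) (b , b′) (c , c′) = cong₂ _,_ (identity a b c) (identity a′ b′ c′)
  where
  identity : ∀ a b c → -1ℤ * b + (1ℤ * a + c) ≡ (a - b) + c
  identity = solve-∀

infix 30 _⁺ _⁻

_⁺ : ℤ → ℕ
(+ n) ⁺ = n
-[1+ n ] ⁺ = 0

_⁻ : ℤ → ℕ
(+ n) ⁻ = 0
-[1+ n ] ⁻ = suc n

x≡x⁺-x⁻ : ∀ x → x ≡ + x ⁺ - + x ⁻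
x≡x⁺-x⁻ (+ n) = sym (ℤP.+-identityʳ (+ n))
x≡x⁺-x⁻ -[1+ n ] = refl

x≤x⁺ : ∀ x → x ℤ.≤ + x ⁺
x≤x⁺ (+ n) = ℤP.≤-refl
x≤x⁺ -[1+ n ] = ℤ.-≤+

[x+y]⁺≤x⁺+y⁺ : ∀ x y → (x + y) ⁺ ≤ x ⁺ ℕ.+ y ⁺
[x+y]⁺≤x⁺+y⁺ x y with x + y in eq
... | + n = ℤP.drop‿+≤+ (subst (ℤ._≤ + x ⁺ + + y ⁺) eq (ℤP.+-mono-≤ (x≤x⁺ x) (x≤x⁺ y)))
... | -[1+ n ] = z≤n

x⁺>0⇒x⁻≡0 : ∀ x → 1 ≤ x ⁺ → x ⁻ ≡ 0
x⁺>0⇒x⁻≡0 (+ n) _ = refl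

-- Counting finite sets

InjectiveOn : {A B : Set} → (A → Set) → (A → B) → Set
InjectiveOn Q f = ∀ x y → Q x → Q y → f x ≡ f y → x ≡ y

injective⇒surjective : ∀ {n} (f : Fin n → Fin n) → Injective _≡_ _≡_ f → ∀ y → ∃[ x ] f x ≡ y
injective⇒surjective {suc n} f inj y with any? (λ x → f x ≟ y)
... | yes hit = hit
... | no miss = ⊥-elim (ℕP.1+n≰n (injective⇒≤ {f = f-y} f-y-injective))
  where
  f-y : Fin (suc n) → Fin n
  f-y x = punchOut {i = y} {j = f x} (λ eq → miss (x , sym eq))
  f-y-injective : Injective _≡_ _≡_ f-y
  f-y-injective {x} {x′} eq =
    inj (punchOut-injective (λ e → miss (x , sym e)) (λ e → miss (x′ , sym e)) eq)

IsCard-resp : {A : Set} {P Q : A → Set} {n : ℕ} → (∀ x → P x ⇔ Q x) → IsCard P n → IsCard Q n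
IsCard-resp P⇔Q (e , e-inj , e∈P , P⊆e) =
  e , e-inj , (λ i → Equivalence.to (P⇔Q (e i)) (e∈P i)) ,
  (λ x q → P⊆e x (Equivalence.from (P⇔Q x) q))

IsCard-∪ : {A : Set} {P Q : A → Set} {m n : ℕ} → (∀ x → P x → Q x → ⊥) →
  IsCard P m → IsCard Q n → IsCard (λ x → P x ⊎ Q x) (m ℕ.+ n)
IsCard-∪ {A} {P} {Q} {m} {n} disjoint (e₁ , e₁-inj , e₁∈P , P⊆e₁) (e₂ , e₂-inj , e₂∈Q , Q⊆e₂) =
  e , e-injective , e∈P∪Q , P∪Q⊆e
  where
  e : Fin (m ℕ.+ n) → A
  e = [ e₁ , e₂ ] ∘ splitAt m

  e∈P∪Q : ∀ i → P (e i) ⊎ Q (e i)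
  e∈P∪Q i with splitAt m i
  ... | inj₁ i₁ = inj₁ (e₁∈P i₁)
  ... | inj₂ i₂ = inj₂ (e₂∈Q i₂)

  P∪Q⊆e : ∀ x → P x ⊎ Q x → ∃[ i ] e i ≡ x
  P∪Q⊆e x (inj₁ p) with i , refl ← P⊆e₁ x p = i F.↑ˡ n , cong [ e₁ , e₂ ] (splitAt-↑ˡ m i n)
  P∪Q⊆e x (inj₂ q) with i , refl ← Q⊆e₂ x q = m F.↑ʳ i , cong [ e₁ , e₂ ] (splitAt-↑ʳ m n i)

  splitAt-injective : ∀ {i j} → splitAt m i ≡ splitAt m j → i ≡ j
  splitAt-injective {i} {j} eq =
    trans (sym (join-splitAt m n i)) (trans (cong (join m n) eq) (join-splitAt m n j))

  e-injective : Injective _≡_ _≡_ e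
  e-injective {i} {j} eq with splitAt m i in eqᵢ | splitAt m j in eqⱼ
  ... | inj₁ i₁ | inj₁ j₁ = splitAt-injective (trans eqᵢ (trans (cong inj₁ (e₁-inj eq)) (sym eqⱼ)))
  ... | inj₂ i₂ | inj₂ j₂ = splitAt-injective (trans eqᵢ (trans (cong inj₂ (e₂-inj eq)) (sym eqⱼ)))
  ... | inj₁ i₁ | inj₂ j₂ = ⊥-elim (disjoint _ (e₁∈P i₁) (subst Q (sym eq) (e₂∈Q j₂)))
  ... | inj₂ i₂ | inj₁ j₁ = ⊥-elim (disjoint _ (e₁∈P j₁) (subst Q eq (e₂∈Q i₂)))

⋃⁺ : {A : Set} → (ℕ → A → Set) → ℕ → A → Set
⋃⁺ P k x = ∃[ j ] (1 ≤ j × j ≤ k × P j x)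

⋃⁺-suc : {A : Set} (P : ℕ → A → Set) (k : ℕ) (x : A) → (⋃⁺ P k x ⊎ P (suc k) x) ⇔ ⋃⁺ P (suc k) x
⋃⁺-suc P k x = mk⇔ merge split
  where
  split : ⋃⁺ P (suc k) x → ⋃⁺ P k x ⊎ P (suc k) x
  split (j , 1≤j , j≤1+k , p) with ℕP.m≤n⇒m<n∨m≡n j≤1+k
  ... | inj₁ (s≤s j≤k) = inj₁ (j , 1≤j , j≤k , p)
  ... | inj₂ refl = inj₂ p
  merge : ⋃⁺ P k x ⊎ P (suc k) x → ⋃⁺ P (suc k) x
  merge (inj₁ (j , 1≤j , j≤k , p)) = j , 1≤j , ℕP.m≤n⇒m≤1+n j≤k , p
  merge (inj₂ p) = suc k , s≤s z≤n , ℕP.≤-refl , p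

IsCard-⋃⁺ : {A : Set} {P : ℕ → A → Set} {h : ℕ → ℕ} →
  (∀ x {j j′} → P j x → P j′ x → j ≡ j′) → (∀ j → IsCard (P j) (h j)) →
  ∀ k → IsCard (⋃⁺ P k) (sum1to h k)
IsCard-⋃⁺ disjoint |P| zero = (λ ()) , (λ {}) , (λ ()) , λ { x (j , 1≤j , j≤0 , _) → ⊥-elim (ℕP.<⇒≱ 1≤j j≤0) }
IsCard-⋃⁺ {P = P} disjoint |P| (suc k) =
  IsCard-resp (⋃⁺-suc P k)
    (IsCard-∪ new (IsCard-⋃⁺ disjoint |P| k) (|P| (suc k)))
  where
  new : ∀ x → ⋃⁺ P k x → P (suc k) x → ⊥
  new x (j , _ , j≤k , p) q with refl ← disjoint x p q = ℕP.1+n≰n j≤k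

module _ {A B : Set} {P : B → Set} {Q : A → Set} {c n : ℕ} (f : A → B)
         (|P| : IsCard P c) (|Q| : IsCard Q n) where

  private
    e = proj₁ |P|
    e-injective = proj₁ (proj₂ |P|)
    e∈P = proj₁ (proj₂ (proj₂ |P|))
    P⊆e = proj₂ (proj₂ (proj₂ |P|))
    g = proj₁ |Q|
    g-injective = proj₁ (proj₂ |Q|)
    g∈Q = proj₁ (proj₂ (proj₂ |Q|))
    Q⊆g = proj₂ (proj₂ (proj₂ |Q|))

  injectiveOn⇒≤ : (∀ y → Q y → P (f y)) → InjectiveOn Q f → n ≤ c
  injectiveOn⇒≤ Q⇒P f-injective = injective⇒≤ {f = index} index-injective
    where
    located : ∀ s → ∃[ i ] e i ≡ f (g s)
    located s = P⊆e (f (g s)) (Q⇒P (g s) (g∈Q s))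
    index : Fin n → Fin c
    index = proj₁ ∘ located
    index-injective : Injective _≡_ _≡_ index
    index-injective {s} {s′} eq = g-injective (f-injective (g s) (g s′) (g∈Q s) (g∈Q s′)
      (trans (sym (proj₂ (located s))) (trans (cong e eq) (proj₂ (located s′)))))

  module _ (cover : ∀ x → P x → ∃[ y ] (Q y × f y ≡ x)) where

    private
      preimage : Fin c → Fin n
      preimage i = proj₁ (Q⊆g _ (proj₁ (proj₂ (cover (e i) (e∈P i)))))

      f∘g∘preimage : ∀ i → f (g (preimage i)) ≡ e i
      f∘g∘preimage i with cover (e i) (e∈P i)
      ... | y , q , fy≡ei = trans (cong f (proj₂ (Q⊆g y q))) fy≡ei

      preimage-injective : Injective _≡_ _≡_ preimage
      preimage-injective {i} {i′} eq =
        e-injective (trans (sym (f∘g∘preimage i)) (trans (cong (f ∘ g) eq) (f∘g∘preimage i′)))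

    covered⇒≤ : c ≤ n
    covered⇒≤ = injective⇒≤ preimage-injective

    covered∧≡⇒injectiveOn : c ≡ n → (∀ y → Q y → P (f y)) × InjectiveOn Q f
    covered∧≡⇒injectiveOn refl = Q⇒P , f-injective
      where
      via-preimage : ∀ y → Q y → ∃[ i ] g (preimage i) ≡ y
      via-preimage y q with s , refl ← Q⊆g y q
                      with i , refl ← injective⇒surjective preimage preimage-injective s = i , refl
      Q⇒P : ∀ y → Q y → P (f y)
      Q⇒P y q with i , refl ← via-preimage y q = subst P (sym (f∘g∘preimage i)) (e∈P i)
      f-injective : InjectiveOn Q f
      f-injective y y′ q q′ eq with i , refl ← via-preimage y q | i′ , refl ← via-preimage y′ q′ =
        cong (g ∘ preimage) (e-injective (trans (sym (f∘g∘preimage i)) (trans eq (f∘g∘preimage i′))))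

mass : ∀ {m} → (ℤ → ℕ) → Vec ℤ m → ℕ
mass μ [] = 0
mass μ (x ∷ a) = μ x ℕ.+ mass μ a

Σ⁺ Σ⁻ : ∀ {m} → Vec ℤ m → ℕ
Σ⁺ = mass _⁺
Σ⁻ = mass _⁻

posSum≡Σ⁺ : ∀ {m} (a : Vec ℤ m) → posSum a ≡ + Σ⁺ a
posSum≡Σ⁺ [] = refl
posSum≡Σ⁺ (x ∷ a) = cong₂ _+_ (positive-branch x) (posSum≡Σ⁺ a)
  where
  positive-branch : ∀ x → (if does (0ℤ <? x) then x else 0ℤ) ≡ + x ⁺
  positive-branch (+ zero) = refl
  positive-branch (+ suc n) = refl
  positive-branch -[1+ n ] = refl

sumℤ≡Σ⁺-Σ⁻ : ∀ {m} (a : Vec ℤ m) → sumℤ a ≡ + Σ⁺ a - + Σ⁻ a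
sumℤ≡Σ⁺-Σ⁻ [] = refl
sumℤ≡Σ⁺-Σ⁻ (x ∷ a) = begin
  x + sumℤ a                                    ≡⟨ cong₂ _+_ (x≡x⁺-x⁻ x) (sumℤ≡Σ⁺-Σ⁻ a) ⟩
  (+ x ⁺ - + x ⁻) + (+ Σ⁺ a - + Σ⁻ a)           ≡⟨ -+-interchange (+ x ⁺) (+ x ⁻) (+ Σ⁺ a) (+ Σ⁻ a) ⟩
  (+ x ⁺ + + Σ⁺ a) - (+ x ⁻ + + Σ⁻ a)           ∎
  where open ≡-Reasoning

sumℤ≡0⇒Σ⁺≡Σ⁻ : ∀ {m} (a : Vec ℤ m) → sumℤ a ≡ 0ℤ → Σ⁺ a ≡ Σ⁻ a
sumℤ≡0⇒Σ⁺≡Σ⁻ a sum≡0 = ℤP.+-injective (ℤP.i-j≡0⇒i≡j _ _ (trans (sym (sumℤ≡Σ⁺-Σ⁻ a)) sum≡0))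

Σ⁺≡0∧Σ⁻≡0⇒≡0 : ∀ {m} (a : Vec ℤ m) → Σ⁺ a ≡ 0 → Σ⁻ a ≡ 0 → a ≡ replicate m 0ℤ
Σ⁺≡0∧Σ⁻≡0⇒≡0 [] _ _ = refl
Σ⁺≡0∧Σ⁻≡0⇒≡0 (+ zero ∷ a) Σ⁺≡0 Σ⁻≡0 = cong (0ℤ ∷_) (Σ⁺≡0∧Σ⁻≡0⇒≡0 a Σ⁺≡0 Σ⁻≡0)

Σ⁺-replicate : ∀ m → Σ⁺ (replicate m 0ℤ) ≡ 0
Σ⁺-replicate zero = refl
Σ⁺-replicate (suc m) = Σ⁺-replicate m

sumℤ-replicate : ∀ m → sumℤ (replicate m 0ℤ) ≡ 0ℤ
sumℤ-replicate zero = refl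
sumℤ-replicate (suc m) = cong (λ s → 0ℤ + s) (sumℤ-replicate m)

linComb-replicate : ∀ {m} (v : Fin m → ℤ²) → linComb (replicate m 0ℤ) v ≡ 0²
linComb-replicate {zero} v = refl
linComb-replicate {suc m} v = cong₂ _+²_ (·²-zeroˡ (v F.zero)) (linComb-replicate (v ∘ F.suc))

infixl 6 _[_]+=_

_[_]+=_ : ∀ {m} → Vec ℤ m → Fin m → ℤ → Vec ℤ m
a [ i ]+= x = a [ i ]%= λ y → x + y

sumℤ-+= : ∀ {m} (a : Vec ℤ m) i x → sumℤ (a [ i ]+= x) ≡ x + sumℤ a
sumℤ-+= (y ∷ a) F.zero x = ℤP.+-assoc x y (sumℤ a)
sumℤ-+= (y ∷ a) (F.suc i) x = trans (cong (λ s → y + s) (sumℤ-+= a i x)) (ℤ+.x∙yz≈y∙xz y x (sumℤ a))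

Σ⁺-+= : ∀ {m} (a : Vec ℤ m) i x → Σ⁺ (a [ i ]+= x) ≤ x ⁺ ℕ.+ Σ⁺ a
Σ⁺-+= (y ∷ a) F.zero x = begin
  (x + y) ⁺ ℕ.+ Σ⁺ a      ≤⟨ ℕP.+-monoˡ-≤ (Σ⁺ a) ([x+y]⁺≤x⁺+y⁺ x y) ⟩
  (x ⁺ ℕ.+ y ⁺) ℕ.+ Σ⁺ a  ≡⟨ ℕP.+-assoc (x ⁺) (y ⁺) (Σ⁺ a) ⟩
  x ⁺ ℕ.+ (y ⁺ ℕ.+ Σ⁺ a)  ∎
  where open ℕP.≤-Reasoning
Σ⁺-+= (y ∷ a) (F.suc i) x = begin
  y ⁺ ℕ.+ Σ⁺ (a [ i ]+= x)      ≤⟨ ℕP.+-monoʳ-≤ (y ⁺) (Σ⁺-+= a i x) ⟩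
  y ⁺ ℕ.+ (x ⁺ ℕ.+ Σ⁺ a)         ≡⟨ ℕ+.x∙yz≈y∙xz (y ⁺) (x ⁺) (Σ⁺ a) ⟩
  x ⁺ ℕ.+ (y ⁺ ℕ.+ Σ⁺ a)         ∎
  where open ℕP.≤-Reasoning

linComb-+= : ∀ {m} (a : Vec ℤ m) i x (v : Fin m → ℤ²) →
  linComb (a [ i ]+= x) v ≡ (x ·² v i) +² linComb a v
linComb-+= (y ∷ a) F.zero x v =
  trans (cong (_+² linComb a (v ∘ F.suc)) (·²-distribʳ-+ x y (v F.zero))) (+²-assoc (x ·² v F.zero) (y ·² v F.zero) _)
linComb-+= (y ∷ a) (F.suc i) x v =
  trans (cong ((y ·² v F.zero) +²_) (linComb-+= a i x (v ∘ F.suc))) (+²-leftCommute (y ·² v F.zero) (x ·² v (F.suc i)) _)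

-- From a sum of differences to a tuple

coefficients : ∀ {m} → List (Fin m × Fin m) → Vec ℤ m
coefficients {m} [] = replicate m 0ℤ
coefficients ((α , β) ∷ ps) = coefficients ps [ α ]+= 1ℤ [ β ]+= -1ℤ

sumDiffs≡linComb-coefficients : ∀ {m} (v : Fin m → ℤ²) ps → sumDiffs v ps ≡ linComb (coefficients ps) v
sumDiffs≡linComb-coefficients v [] = sym (linComb-replicate v)
sumDiffs≡linComb-coefficients v ((α , β) ∷ ps) = begin
  (v α -² v β) +² sumDiffs v ps                        ≡⟨ cong ((v α -² v β) +²_) (sumDiffs≡linComb-coefficients v ps) ⟩
  (v α -² v β) +² linComb c v                          ≡⟨ sym (-1·q+²[1·p+²r]≡[p-²q]+²r (v α) (v β) (linComb c v)) ⟩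
  (-1ℤ ·² v β) +² ((1ℤ ·² v α) +² linComb c v)         ≡⟨ cong ((-1ℤ ·² v β) +²_) (sym (linComb-+= c α 1ℤ v)) ⟩
  (-1ℤ ·² v β) +² linComb (c [ α ]+= 1ℤ) v             ≡⟨ sym (linComb-+= (c [ α ]+= 1ℤ) β -1ℤ v) ⟩
  linComb (c [ α ]+= 1ℤ [ β ]+= -1ℤ) v                 ∎
  where
  open ≡-Reasoning
  c = coefficients ps

sumℤ-coefficients : ∀ {m} (ps : List (Fin m × Fin m)) → sumℤ (coefficients ps) ≡ 0ℤ
sumℤ-coefficients {m} [] = sumℤ-replicate m
sumℤ-coefficients ((α , β) ∷ ps) =
  trans (sumℤ-+= (c [ α ]+= 1ℤ) β -1ℤ)
        (cong (λ s → -1ℤ + s) (trans (sumℤ-+= c α 1ℤ) (cong (λ s → 1ℤ + s) (sumℤ-coefficients ps))))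
  where c = coefficients ps

Σ⁺-coefficients : ∀ {m} (ps : List (Fin m × Fin m)) → Σ⁺ (coefficients ps) ≤ length ps
Σ⁺-coefficients {m} [] = ℕP.≤-reflexive (Σ⁺-replicate m)
Σ⁺-coefficients ((α , β) ∷ ps) =
  ℕP.≤-trans (Σ⁺-+= (c [ α ]+= 1ℤ) β -1ℤ) (ℕP.≤-trans (Σ⁺-+= c α 1ℤ) (s≤s (Σ⁺-coefficients ps)))
  where c = coefficients ps

-- From a tuple to a sum of differences

sumOver : ∀ {m} → (Fin m → ℤ²) → List (Fin m) → ℤ²
sumOver v [] = 0²
sumOver v (i ∷ is) = v i +² sumOver v is

indices : ∀ {m} → (ℤ → ℕ) → Vec ℤ m → List (Fin m)
indices μ [] = []
indices μ (x ∷ a) = List.replicate (μ x) F.zero ++ map F.suc (indices μ a)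

length-indices : ∀ {m} μ (a : Vec ℤ m) → length (indices μ a) ≡ mass μ a
length-indices μ [] = refl
length-indices μ (x ∷ a) =
  trans (ListP.length-++ (List.replicate (μ x) F.zero))
        (cong₂ ℕ._+_ (ListP.length-replicate (μ x)) (trans (ListP.length-map F.suc (indices μ a)) (length-indices μ a)))

All-indices : ∀ {m} μ (a : Vec ℤ m) → All (λ i → 1 ≤ μ (lookup a i)) (indices μ a)
All-indices μ [] = []
All-indices μ (x ∷ a) = ++⁺ (leading (μ x) refl) (map⁺ (All-indices μ a))
  where
  leading : ∀ n → μ x ≡ n → All (λ i → 1 ≤ μ (lookup (x ∷ a) i)) (List.replicate n F.zero)
  leading zero _ = []
  leading (suc n) μx≡1+n = replicate⁺ (suc n) (subst (1 ≤_) (sym μx≡1+n) (s≤s z≤n))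

sumOver-map-suc : ∀ {m} (v : Fin (suc m) → ℤ²) is → sumOver v (map F.suc is) ≡ sumOver (v ∘ F.suc) is
sumOver-map-suc v [] = refl
sumOver-map-suc v (i ∷ is) = cong (v (F.suc i) +²_) (sumOver-map-suc v is)

sumOver-replicate-++ : ∀ {m} (v : Fin (suc m) → ℤ²) n is →
  sumOver v (List.replicate n F.zero ++ map F.suc is) ≡ ((+ n) ·² v F.zero) +² sumOver (v ∘ F.suc) is
sumOver-replicate-++ v zero is =
  trans (sumOver-map-suc v is) (sym (trans (cong (_+² sumOver (v ∘ F.suc) is) (·²-zeroˡ (v F.zero))) (+²-identityˡ _)))
sumOver-replicate-++ v (suc n) is = begin
  p +² sumOver v (List.replicate n F.zero ++ map F.suc is)  ≡⟨ cong (p +²_) (sumOver-replicate-++ v n is) ⟩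
  p +² (n·p +² s)                                           ≡⟨ sym (+²-assoc p n·p s) ⟩
  (p +² n·p) +² s                                           ≡⟨ cong (λ q → (q +² n·p) +² s) (sym (·²-identityˡ p)) ⟩
  ((1ℤ ·² p) +² n·p) +² s                                   ≡⟨ cong (_+² s) (sym (·²-distribʳ-+ 1ℤ (+ n) p)) ⟩
  ((+ suc n) ·² p) +² s                                     ∎
  where
  open ≡-Reasoning
  p = v F.zero
  n·p = (+ n) ·² p
  s = sumOver (v ∘ F.suc) is

linComb≡positive-negative : ∀ {m} (a : Vec ℤ m) (v : Fin m → ℤ²) →
  linComb a v ≡ sumOver v (indices _⁺ a) -² sumOver v (indices _⁻ a)
linComb≡positive-negative [] v = refl
linComb≡positive-negative (x ∷ a) v = begin
  (x ·² p) +² linComb a (v ∘ F.suc)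
    ≡⟨ cong₂ (λ y q → (y ·² p) +² q) (x≡x⁺-x⁻ x) (linComb≡positive-negative a (v ∘ F.suc)) ⟩
  ((+ x ⁺ - + x ⁻) ·² p) +² (S⁺ -² S⁻)
    ≡⟨ cong (_+² (S⁺ -² S⁻)) (·²-distribʳ-- (+ x ⁺) (+ x ⁻) p) ⟩
  (((+ x ⁺) ·² p) -² ((+ x ⁻) ·² p)) +² (S⁺ -² S⁻)
    ≡⟨ -²-+²-interchange ((+ x ⁺) ·² p) ((+ x ⁻) ·² p) S⁺ S⁻ ⟩
  (((+ x ⁺) ·² p) +² S⁺) -² (((+ x ⁻) ·² p) +² S⁻)
    ≡⟨ sym (cong₂ _-²_ (sumOver-replicate-++ v (x ⁺) (indices _⁺ a)) (sumOver-replicate-++ v (x ⁻) (indices _⁻ a))) ⟩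
  sumOver v (indices _⁺ (x ∷ a)) -² sumOver v (indices _⁻ (x ∷ a))
    ∎
  where
  open ≡-Reasoning
  p = v F.zero
  S⁺ = sumOver (v ∘ F.suc) (indices _⁺ a)
  S⁻ = sumOver (v ∘ F.suc) (indices _⁻ a)

sumDiffs-zip : ∀ {m} (v : Fin m → ℤ²) xs ys → length xs ≡ length ys →
  sumDiffs v (zip xs ys) ≡ sumOver v xs -² sumOver v ys
sumDiffs-zip v [] [] _ = refl
sumDiffs-zip v (x ∷ xs) (y ∷ ys) eq =
  trans (cong ((v x -² v y) +²_) (sumDiffs-zip v xs ys (ℕP.suc-injective eq)))
        (-²-+²-interchange (v x) (v y) (sumOver v xs) (sumOver v ys))

All-zip : {A B : Set} {P : A → Set} {Q : B → Set} {xs : List A} {ys : List B} →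
  All P xs → All Q ys → All (λ p → P (proj₁ p) × Q (proj₂ p)) (zip xs ys)
All-zip [] _ = []
All-zip (_ ∷ _) [] = []
All-zip (p ∷ ps) (q ∷ qs) = (p , q) ∷ All-zip ps qs

balanced⇒sumDiffs : ∀ {m} (v : Fin m → ℤ²) (a : Vec ℤ m) → sumℤ a ≡ 0ℤ →
  ∃[ ps ] (length ps ≡ Σ⁺ a × All (λ p → proj₁ p ≢ proj₂ p) ps × sumDiffs v ps ≡ linComb a v)
balanced⇒sumDiffs v a sum≡0 =
  zip is⁺ is⁻ ,
  trans (ListP.length-zipWith _,_ is⁺ is⁻)
        (trans (cong (length is⁺ ℕ.⊓_) (sym same-length)) (trans (ℕP.⊓-idem _) (length-indices _⁺ a))) ,
  All.map distinct (All-zip (All-indices _⁺ a) (All-indices _⁻ a)) ,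
  trans (sumDiffs-zip v is⁺ is⁻ same-length) (sym (linComb≡positive-negative a v))
  where
  is⁺ = indices _⁺ a
  is⁻ = indices _⁻ a
  same-length : length is⁺ ≡ length is⁻
  same-length = trans (length-indices _⁺ a) (trans (sumℤ≡0⇒Σ⁺≡Σ⁻ a sum≡0) (sym (length-indices _⁻ a)))
  distinct : ∀ {p} → 1 ≤ lookup a (proj₁ p) ⁺ × 1 ≤ lookup a (proj₂ p) ⁻ → proj₁ p ≢ proj₂ p
  distinct (pos , neg) refl with () ← subst (1 ≤_) (x⁺>0⇒x⁻≡0 _ pos) neg

H-intro : ∀ {m} (a : Vec ℤ m) → sumℤ a ≡ 0ℤ → H m (Σ⁺ a) a
H-intro a sum≡0 = sum≡0 , posSum≡Σ⁺ a

H⇒Σ⁺≡ : ∀ {m j} (a : Vec ℤ m) → H m j a → Σ⁺ a ≡ j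
H⇒Σ⁺≡ a (_ , posSum≡j) = ℤP.+-injective (trans (sym (posSum≡Σ⁺ a)) posSum≡j)

H-disjoint : ∀ {m} (a : Vec ℤ m) {j j′} → H m j a → H m j′ a → j ≡ j′
H-disjoint a hj hj′ = trans (sym (H⇒Σ⁺≡ a hj)) (H⇒Σ⁺≡ a hj′)

H-zero : ∀ m → H m 0 (replicate m 0ℤ)
H-zero m = subst (λ j → H m j (replicate m 0ℤ)) (Σ⁺-replicate m) (H-intro (replicate m 0ℤ) (sumℤ-replicate m))

H-zero⇒≡0 : ∀ {m} (a : Vec ℤ m) → H m 0 a → a ≡ replicate m 0ℤ
H-zero⇒≡0 a h0 = Σ⁺≡0∧Σ⁻≡0⇒≡0 a (H⇒Σ⁺≡ a h0) (trans (sym (sumℤ≡0⇒Σ⁺≡Σ⁻ a (proj₁ h0))) (H⇒Σ⁺≡ a h0))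

module _ {m : ℕ} (v : Fin m → ℤ²) {k : ℕ} where

  H-zero⇒linComb≡0 : ∀ a → H m 0 a → linComb a v ≡ 0²
  H-zero⇒linComb≡0 a h0 = trans (cong (λ b → linComb b v) (H-zero⇒≡0 a h0)) (linComb-replicate v)

  CkSet⇒⋃⁺H : ∀ w → CkSet v k w → ∃[ a ] (⋃⁺ (H m) k a × linComb a v ≡ w)
  CkSet⇒⋃⁺H w (w≢0 , ps , length≤k , _ , sumDiffs≡w) =
    a , (Σ⁺ a , 1≤Σ⁺a , ℕP.≤-trans (Σ⁺-coefficients ps) length≤k , ha) , linComb≡w
    where
    a = coefficients ps
    ha : H m (Σ⁺ a) a
    ha = H-intro a (sumℤ-coefficients ps)
    linComb≡w : linComb a v ≡ w
    linComb≡w = trans (sym (sumDiffs≡linComb-coefficients v ps)) sumDiffs≡w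
    1≤Σ⁺a : 1 ≤ Σ⁺ a
    1≤Σ⁺a = ℕP.n≢0⇒n>0 λ Σ⁺a≡0 →
      w≢0 (trans (sym linComb≡w) (H-zero⇒linComb≡0 a (subst (λ j → H m j a) Σ⁺a≡0 ha)))

  ⋃⁺H⇒CkSet : ∀ a → ⋃⁺ (H m) k a → linComb a v ≢ 0² → CkSet v k (linComb a v)
  ⋃⁺H⇒CkSet a (j , _ , j≤k , hj) ≢0 with ps , length≡ , distinct , sumDiffs≡ ← balanced⇒sumDiffs v a (proj₁ hj) =
    ≢0 , ps , subst (_≤ k) (sym (trans length≡ (H⇒Σ⁺≡ a hj))) j≤k , distinct , sumDiffs≡

  DistinctReps⇒injectiveOn : DistinctReps v k → InjectiveOn (⋃⁺ (H m) k) (λ a → linComb a v)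
  DistinctReps⇒injectiveOn distinct a b (j , _ , j≤k , hj) (j′ , _ , j′≤k , hj′) =
    distinct a b (j , j≤k , hj) (j′ , j′≤k , hj′)

  DistinctReps⇒≢0 : DistinctReps v k → ∀ a → ⋃⁺ (H m) k a → linComb a v ≢ 0²
  DistinctReps⇒≢0 distinct a (j , 1≤j , j≤k , hj) linComb≡0
    with refl ← distinct a (replicate m 0ℤ) (j , j≤k , hj) (0 , z≤n , H-zero m) (trans linComb≡0 (sym (linComb-replicate v)))
    with refl ← H-disjoint (replicate m 0ℤ) hj (H-zero m) = ℕP.<-irrefl refl 1≤j

  injectiveOn∧≢0⇒DistinctReps : InjectiveOn (⋃⁺ (H m) k) (λ a → linComb a v) →
    (∀ a → ⋃⁺ (H m) k a → linComb a v ≢ 0²) → DistinctReps v k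
  injectiveOn∧≢0⇒DistinctReps injective ≢0 a b (zero , _ , ha) (zero , _ , hb) _ =
    trans (H-zero⇒≡0 a ha) (sym (H-zero⇒≡0 b hb))
  injectiveOn∧≢0⇒DistinctReps injective ≢0 a b (zero , _ , ha) (suc _ , j′≤k , hb) eq =
    ⊥-elim (≢0 b (_ , s≤s z≤n , j′≤k , hb) (trans (sym eq) (H-zero⇒linComb≡0 a ha)))
  injectiveOn∧≢0⇒DistinctReps injective ≢0 a b (suc _ , j≤k , ha) (zero , _ , hb) eq =
    ⊥-elim (≢0 a (_ , s≤s z≤n , j≤k , ha) (trans eq (H-zero⇒linComb≡0 b hb)))
  injectiveOn∧≢0⇒DistinctReps injective ≢0 a b (suc _ , j≤k , ha) (suc _ , j′≤k , hb) eq =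
    injective a b (_ , s≤s z≤n , j≤k , ha) (_ , s≤s z≤n , j′≤k , hb) eq

theorem7 : (m : ℕ) (v : Fin m → ℤ²) → IsDD v →
    (k : ℕ) → 1 ≤ k →
    (c : ℕ) → IsCard (CkSet v k) c →
    (h : ℕ → ℕ) → (∀ j → IsCard (H m j) (h j)) →
    (c ≤ sum1to h k) × ((c ≡ sum1to h k) ⇔ DistinctReps v k)
theorem7 m v _ k _ c |Ck| h |H| = c≤S , mk⇔ to from
  where
  lc : Vec ℤ m → ℤ²
  lc a = linComb a v
  |U| : IsCard (⋃⁺ (H m) k) (sum1to h k)
  |U| = IsCard-⋃⁺ H-disjoint |H| k
  c≤S : c ≤ sum1to h k
  c≤S = covered⇒≤ lc |Ck| |U| (CkSet⇒⋃⁺H v)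
  to : c ≡ sum1to h k → DistinctReps v k
  to c≡S with into , injective ← covered∧≡⇒injectiveOn lc |Ck| |U| (CkSet⇒⋃⁺H v) c≡S =
    injectiveOn∧≢0⇒DistinctReps v injective (λ a u → proj₁ (into a u))
  from : DistinctReps v k → c ≡ sum1to h k
  from distinct = ℕP.≤-antisym c≤S (injectiveOn⇒≤ lc |Ck| |U|
    (λ a u → ⋃⁺H⇒CkSet v a u (DistinctReps⇒≢0 v distinct a u)) (DistinctReps⇒injectiveOn v distinct))
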